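{- For every finite simple graph $G$ with minimum degree $\delta(G)\ge 2$, $\mathrm{Maj}(G)\le 2\Delta(G)+1$, where $\Delta(G)$ is the maximum degree. Moreover, for infinitely many integers $\Delta$ there exist graphs $G$ with $\Delta(G)=\Delta$ and $\mathrm{Maj}(G)=2\Delta(G)+1$.
   Context: Graphs are finite, simple and undirected. A strong majority vertex-coloring of a graph $G=(V,E)$ is a (not necessarily proper) map $c:V\to C$ into a set $C$ of colors such that for every vertex $v\in V$ and every color $\alpha\in C$, at most half of the neighbors of $v$ have color $\alpha$. The strong majority number $\mathrm{Maj}(G)$ is the least number of colors in such a coloring; it is defined for graphs with minimum degree at least $2$. -}

module Defs where

open import Data.Nat using (ℕ; zero; suc; _+_; _*_; _≤_; _<_; _⊔_)
open import Data.Bool using (Bool; true; false; _∧_)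
open import Data.Fin using (Fin; zero; suc; _≟_)
open import Data.List using (List; foldr; map; allFin)
open import Data.Product using (Σ; _×_; ∃)
open import Relation.Nullary using (¬_)
open import Relation.Nullary.Decidable using (⌊_⌋)
open import Relation.Binary.PropositionalEquality using (_≡_)

record Graph : Set where
  field
    n      : ℕ
    adj    : Fin n → Fin n → Bool
    sym    : ∀ u v → adj u v ≡ adj v u
    irrefl : ∀ v → adj v v ≡ false
open Graph public

b2n : Bool → ℕ
b2n true  = 1
b2n false = 0

count : {m : ℕ} → (Fin m → Bool) → ℕ
count {zero}  p = 0
count {suc m} p = b2n (p zero) + count (λ i → p (suc i))

deg : (G : Graph) → Fin (n G) → ℕ
deg G v = count (adj G v)

MinDegAtLeast : Graph → ℕ → Set
MinDegAtLeast G d = ∀ v → d ≤ deg G v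

maxDeg : Graph → ℕ
maxDeg G = foldr _⊔_ 0 (map (deg G) (allFin (n G)))

colourDeg : (G : Graph) {k : ℕ} → (Fin (n G) → Fin k) → Fin (n G) → Fin k → ℕ
colourDeg G c v α = count (λ u → adj G v u ∧ ⌊ c u ≟ α ⌋)

IsStrongMajorityColouring : (G : Graph) {k : ℕ} → (Fin (n G) → Fin k) → Set
IsStrongMajorityColouring G c = ∀ v α → 2 * colourDeg G c v α ≤ deg G v

HasStrongMajorityColouring : Graph → ℕ → Set
HasStrongMajorityColouring G k =
  Σ (Fin (n G) → Fin k) (λ c → IsStrongMajorityColouring G c)

MajIs : Graph → ℕ → Set
MajIs G k = HasStrongMajorityColouring G k
          × (∀ j → j < k → ¬ HasStrongMajorityColouring G j)

{-# OPTIONS --safe #-}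
module Submission where

-- List the neighbours of a vertex v and pair them up consecutively, the last
-- three forming a triangle when deg v is odd.  A colouring that separates every such pair and
-- triangle gives each colour to at most ⌊deg v / 2⌋ neighbours of v, provided deg v ≠ 1.  A
-- vertex u has at most two partners in the pairing at each of its at most Δ neighbours, so
-- greedy colouring separates all pairings with 2Δ + 1 colours.  Having a strong majority
-- colouring with k colours is decidable, so a least such k exists.
--
-- In a strong majority colouring the neighbours of a vertex of degree 3 get
-- three distinct colours.  In the incidence graph of a Steiner triple system any two points lie
-- on a common block, so all points get distinct colours.  For the lines of the affine space 𝔽₃ᵏ
-- there are 3ᵏ points, each on Δ = (3ᵏ − 1)/2 lines, so 2Δ + 1 colours are needed.

open import Defs hiding (sym)
open import Data.Bool using (Bool; true; false; _∧_; T; if_then_else_)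
open import Data.Bool.Properties using (∧-identityʳ; ∧-zeroʳ; T-∧)
open import Data.Fin
  using (Fin; zero; suc; toℕ; fromℕ<; _≟_; splitAt; join; remQuot; quotRem; combine; _↑ˡ_; _↑ʳ_)
open import Data.Fin.Properties
  using (toℕ-fromℕ<; toℕ-injective; toℕ<n; ¬∀⟶∃¬; injective⇒≤; any?; all?; ↑ˡ-injective;
         splitAt-↑ˡ; splitAt-↑ʳ; remQuot-combine; combine-remQuot)
open import Data.List using (List; []; _∷_; _++_; length; map; filter; filterᵇ; concat; tabulate; allFin; lookup)
open import Data.List.Properties
  using (length-++; length-map; filter-++; filter-none; foldr-preservesᵇ; foldr-preservesᵒ)
open import Data.List.Membership.Propositional using (_∈_; _∉_)
open import Data.List.Membership.Propositional.Properties
  using (∈-++⁺ʳ; ∈-map⁺; ∈-allFin; ∈-concat⁺′; ∈-tabulate⁺)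
open import Data.List.Relation.Unary.All using (All; []; _∷_)
import Data.List.Relation.Unary.All as All
import Data.List.Relation.Unary.All.Properties as All
open import Data.List.Relation.Unary.Any using (here; there; index)
import Data.List.Relation.Unary.Any as Any
open import Data.List.Relation.Unary.Any.Properties using (lookup-index)
open import Data.List.Relation.Unary.AllPairs using (AllPairs; []; _∷_)
open import Data.List.Relation.Unary.Unique.Propositional using (Unique)
import Data.List.Relation.Unary.Unique.Propositional.Properties as Unique
open import Data.Nat using (ℕ; zero; suc; _+_; _*_; _^_; _≤_; _<_; _≤?_; z≤n; s≤s; s≤s⁻¹)
open import Data.Nat.DivMod using (_mod_)
open import Data.Nat.Properties
  using (+-assoc; +-comm; +-identityʳ; *-identityʳ; *-distribʳ-+; *-distribˡ-+; ≤-refl; ≤-reflexive;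
         ≤-trans; ≤-antisym; n≤1+n; m≤m+n; m≤n+m; +-mono-≤; +-monoʳ-≤; *-monoʳ-≤; <-irrefl; ≤∧≢⇒<;
         <⇒≱; m<n⇒m<1+n; ⊔-lub; m≤n⇒m≤n⊔o; m≤n⇒m≤o⊔n; m^n>0; module ≤-Reasoning)
import Data.Nat.Properties as ℕ
open import Data.Nat.Solver using (module +-*-Solver)
open import Data.Product using (Σ; ∃; _×_; _,_; proj₁; proj₂; uncurry)
import Data.Product as Product
open import Data.Sum using (_⊎_; inj₁; inj₂; [_,_]′)
import Data.Sum as Sum
open import Data.Vec.Functional using (updateAt) renaming (_∷_ to _∷ᶠ_)
open import Data.Vec.Functional.Properties using (updateAt-updates; updateAt-minimal)
open import Function using (_∘_; case_of_)
open import Function.Bundles using (Equivalence; _⇔_; mk⇔)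
open import Relation.Nullary using (¬_; yes; no; Dec; contradiction)
open import Relation.Nullary.Decidable using (⌊_⌋; map′; fromWitness; toWitness; isYes≗does; does-⇔; ⌊⌋-map′)
open import Relation.Unary using (Pred; Decidable)
open import Relation.Binary.PropositionalEquality

-- Counting

count-cong : ∀ {m} (p q : Fin m → Bool) → (∀ i → p i ≡ q i) → count p ≡ count q
count-cong {zero}  p q eq = refl
count-cong {suc m} p q eq = cong₂ _+_ (cong b2n (eq zero)) (count-cong _ _ (λ i → eq (suc i)))

count-false : ∀ m → count {m} (λ _ → false) ≡ 0
count-false zero    = refl
count-false (suc m) = count-false m

count-true : ∀ m → count {m} (λ _ → true) ≡ m
count-true zero    = refl
count-true (suc m) = cong suc (count-true m)

count-∧-false : ∀ {m} (p : Fin m → Bool) → count (λ i → p i ∧ false) ≡ 0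
count-∧-false {m} p = trans (count-cong _ _ (λ i → ∧-zeroʳ (p i))) (count-false m)

count-∧ˡ : ∀ {m} b (q : Fin m → Bool) → count (λ i → b ∧ q i) ≡ b2n b * count q
count-∧ˡ     true  q = sym (+-identityʳ (count q))
count-∧ˡ {m} false q = count-false m

count-splitAt : ∀ m {n} (f : Fin m ⊎ Fin n → Bool) →
                count (λ i → f (splitAt m i)) ≡ count (λ i → f (inj₁ i)) + count (λ j → f (inj₂ j))
count-splitAt zero    f = refl
count-splitAt (suc m) f = trans (cong (b2n (f (inj₁ zero)) +_) (count-splitAt m (f ∘ Sum.map₁ suc)))
                                (sym (+-assoc (b2n (f (inj₁ zero))) _ _))

private
  count-remQuot-suc : ∀ {m} n (q : Fin (suc m) × Fin n → Bool) →
                      count (λ w → q (remQuot n w))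
                        ≡ count (λ j → q (zero , j)) + count {m * n} (λ w → q (Product.map₁ suc (remQuot n w)))
  count-remQuot-suc {m} n q =
    count-splitAt n (λ s → q (Product.swap ([ (_, zero) , Product.map₂ suc ∘ quotRem {m} n ]′ s)))

count-remQuot-rows : ∀ {m n r} (q : Fin m × Fin n → Bool) → (∀ i → count (λ j → q (i , j)) ≡ r) →
                     count (λ w → q (remQuot n w)) ≡ m * r
count-remQuot-rows {zero}      q rows = refl
count-remQuot-rows {suc m} {n} q rows = trans (count-remQuot-suc n q)
  (cong₂ _+_ (rows zero) (count-remQuot-rows (q ∘ Product.map₁ suc) (λ i → rows (suc i))))

count-remQuot-× : ∀ {m n} (p : Fin m → Bool) (q : Fin n → Bool) →
                  count (λ w → p (proj₁ (remQuot {m} n w)) ∧ q (proj₂ (remQuot {m} n w))) ≡ count p * count q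
count-remQuot-× {zero}      p q = refl
count-remQuot-× {suc m} {n} p q = begin
  count (λ w → p (proj₁ (remQuot {suc m} n w)) ∧ q (proj₂ (remQuot {suc m} n w)))
    ≡⟨ count-remQuot-suc n (λ (i , j) → p i ∧ q j) ⟩
  count (λ j → p zero ∧ q j) + count (λ w → p (suc (proj₁ (remQuot {m} n w))) ∧ q (proj₂ (remQuot {m} n w)))
    ≡⟨ cong₂ _+_ (count-∧ˡ (p zero) q) (count-remQuot-× (p ∘ suc) q) ⟩
  b2n (p zero) * count q + count (p ∘ suc) * count q
    ≡⟨ *-distribʳ-+ (count q) (b2n (p zero)) _ ⟨
  count p * count q ∎
  where open ≡-Reasoning

count-∧-≟ʳ : ∀ {m} (p : Fin m → Bool) k → count (λ i → p i ∧ ⌊ i ≟ k ⌋) ≡ b2n (p k)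
count-∧-≟ʳ {suc m} p zero    =
  trans (cong₂ _+_ (cong b2n (∧-identityʳ (p zero))) (count-∧-false (p ∘ suc))) (+-identityʳ (b2n (p zero)))
count-∧-≟ʳ {suc m} p (suc k) =
  trans (cong₂ _+_ (cong b2n (∧-zeroʳ (p zero)))
                   (count-cong _ _ (λ i → cong (p (suc i) ∧_) (⌊⌋-map′ _ _ (i ≟ k)))))
        (count-∧-≟ʳ (p ∘ suc) k)

count-≟ʳ : ∀ {m} (k : Fin m) → count (λ i → ⌊ i ≟ k ⌋) ≡ 1
count-≟ʳ = count-∧-≟ʳ (λ _ → true)

count-≟ˡ : ∀ {m} (k : Fin m) → count (λ i → ⌊ k ≟ i ⌋) ≡ 1
count-≟ˡ {suc m} zero    = cong suc (count-false m)
count-≟ˡ {suc m} (suc k) = trans (count-cong _ _ (λ i → ⌊⌋-map′ _ _ (k ≟ i))) (count-≟ˡ k)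

⌊⌋-⇔ : ∀ {a b} {A : Set a} {B : Set b} → A ⇔ B → (a? : Dec A) (b? : Dec B) → ⌊ a? ⌋ ≡ ⌊ b? ⌋
⌊⌋-⇔ A⇔B a? b? = trans (isYes≗does a?) (trans (does-⇔ A⇔B a? b?) (sym (isYes≗does b?)))

count-≟-involution : ∀ {m} (f : Fin m → Fin m) → (∀ x → f (f x) ≡ x) →
                     ∀ x → count (λ y → ⌊ x ≟ f y ⌋) ≡ 1
count-≟-involution f involutive x =
  trans (count-cong _ _ λ y → ⌊⌋-⇔ (x≡fy⇔fx≡y y) (x ≟ f y) (f x ≟ y)) (count-≟ˡ (f x))
  where
  x≡fy⇔fx≡y : ∀ y → (x ≡ f y) ⇔ (f x ≡ y)
  x≡fy⇔fx≡y y = mk⇔ (λ x≡fy → trans (cong f x≡fy) (involutive y))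
                    (λ fx≡y → trans (sym (involutive x)) (cong f fx≡y))

T⇒1≤b2n : ∀ {b} → T b → 1 ≤ b2n b
T⇒1≤b2n {true} _ = ≤-refl

count≥1 : ∀ {m} (p : Fin m → Bool) {i} → T (p i) → 1 ≤ count p
count≥1 p {zero}  pi = ≤-trans (T⇒1≤b2n pi) (m≤m+n _ _)
count≥1 p {suc i} pi = ≤-trans (count≥1 (p ∘ suc) pi) (m≤n+m _ _)

count≥2 : ∀ {m} (p : Fin m → Bool) {i j} → i ≢ j → T (p i) → T (p j) → 2 ≤ count p
count≥2 p {zero}  {zero}  i≢j _  _  = contradiction refl i≢j
count≥2 p {zero}  {suc j} _   pi pj = +-mono-≤ (T⇒1≤b2n pi) (count≥1 (p ∘ suc) pj)
count≥2 p {suc i} {zero}  _   pi pj = +-mono-≤ (T⇒1≤b2n pj) (count≥1 (p ∘ suc) pi)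
count≥2 p {suc i} {suc j} i≢j pi pj = ≤-trans (count≥2 (p ∘ suc) (i≢j ∘ cong suc) pi pj) (m≤n+m _ _)

module _ {a} {A : Set a} where

  count≡length-filterᵇ : ∀ {m} (f : Fin m → A) (p : A → Bool) →
                         count (p ∘ f) ≡ length (filterᵇ p (tabulate f))
  count≡length-filterᵇ {zero}  f p = refl
  count≡length-filterᵇ {suc m} f p with p (f zero)
  ... | true  = cong suc (count≡length-filterᵇ (f ∘ suc) p)
  ... | false = count≡length-filterᵇ (f ∘ suc) p

  count∧≡length-filter : ∀ {m} (f : Fin m → A) (p : A → Bool) {q} {Q : Pred A q} (Q? : Decidable Q) →
                         count (λ i → p (f i) ∧ ⌊ Q? (f i) ⌋) ≡ length (filter Q? (filterᵇ p (tabulate f)))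
  count∧≡length-filter {zero}  f p Q? = refl
  count∧≡length-filter {suc m} f p Q? with p (f zero)
  ... | false = count∧≡length-filter (f ∘ suc) p Q?
  ... | true with Q? (f zero)
  ...   | yes _ = cong suc (count∧≡length-filter (f ∘ suc) p Q?)
  ...   | no  _ = count∧≡length-filter (f ∘ suc) p Q?

  length-concat-tabulate : ∀ {m} (h : Fin m → List A) (p : Fin m → Bool) c →
                           (∀ i → length (h i) ≤ c * b2n (p i)) → length (concat (tabulate h)) ≤ c * count p
  length-concat-tabulate {zero}  h p c bound = z≤n
  length-concat-tabulate {suc m} h p c bound = begin
    length (h zero ++ concat (tabulate (h ∘ suc)))
      ≡⟨ length-++ (h zero) ⟩
    length (h zero) + length (concat (tabulate (h ∘ suc)))
      ≤⟨ +-mono-≤ (bound zero) (length-concat-tabulate (h ∘ suc) (p ∘ suc) c (bound ∘ suc)) ⟩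
    c * b2n (p zero) + c * count (p ∘ suc)
      ≡⟨ *-distribˡ-+ c (b2n (p zero)) _ ⟨
    c * count p ∎
    where open ≤-Reasoning

  length-filter-∷ : ∀ {q} {Q : Pred A q} (Q? : Decidable Q) x xs →
                    length (filter Q? (x ∷ xs)) ≡ b2n ⌊ Q? x ⌋ + length (filter Q? xs)
  length-filter-∷ Q? x xs with Q? x
  ... | yes _ = refl
  ... | no  _ = refl

-- Pairing up a list

module _ {a} {A : Set a} where

  pairing : List A → List (A × A)
  pairing []                       = []
  pairing (_ ∷ [])                 = []
  pairing (x ∷ y ∷ [])             = (x , y) ∷ []
  pairing (x ∷ y ∷ z ∷ [])         = (x , y) ∷ (x , z) ∷ (y , z) ∷ []
  pairing (x ∷ y ∷ zs@(_ ∷ _ ∷ _)) = (x , y) ∷ pairing zs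

  pairing⁺ : ∀ {r} {R : A → A → Set r} {xs} → AllPairs R xs → All (uncurry R) (pairing xs)
  pairing⁺ {xs = []}                _                                = []
  pairing⁺ {xs = _ ∷ []}            _                                = []
  pairing⁺ {xs = _ ∷ _ ∷ []}        ((xy ∷ []) ∷ _)                  = xy ∷ []
  pairing⁺ {xs = _ ∷ _ ∷ _ ∷ []}    ((xy ∷ xz ∷ []) ∷ (yz ∷ []) ∷ _) = xy ∷ xz ∷ yz ∷ []
  pairing⁺ {xs = _ ∷ _ ∷ _ ∷ _ ∷ _} ((xy ∷ _) ∷ _ ∷ rest)            = xy ∷ pairing⁺ rest

  module _ {p} {P : Pred A p} (P? : Decidable P) where

    NotBoth : A → A → Set p
    NotBoth x y = ¬ (P x × P y)

    length-filter≤1 : ∀ {xs} → AllPairs NotBoth xs → length (filter P? xs) ≤ 1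
    length-filter≤1 {[]}     []             = z≤n
    length-filter≤1 {x ∷ xs} (notBoth ∷ ap) with P? x
    ... | yes px rewrite filter-none P? (All.map (λ nb py → nb (px , py)) notBoth) = s≤s z≤n
    ... | no  _  = length-filter≤1 ap

    pairing-majority : ∀ xs → length xs ≢ 1 → All (uncurry NotBoth) (pairing xs) →
                       2 * length (filter P? xs) ≤ length xs
    pairing-majority []               _  _                   = z≤n
    pairing-majority (_ ∷ [])         ≢1 _                   = contradiction refl ≢1
    pairing-majority (x ∷ y ∷ [])     _  (xy ∷ [])           =
      *-monoʳ-≤ 2 (length-filter≤1 ((xy ∷ []) ∷ [] ∷ []))
    pairing-majority (x ∷ y ∷ z ∷ []) _  (xy ∷ xz ∷ yz ∷ []) =
      ≤-trans (*-monoʳ-≤ 2 (length-filter≤1 ((xy ∷ xz ∷ []) ∷ (yz ∷ []) ∷ [] ∷ []))) (n≤1+n 2)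
    pairing-majority (x ∷ y ∷ zs@(_ ∷ _ ∷ _)) _ (xy ∷ rest) = begin
      2 * length (filter P? ((x ∷ y ∷ []) ++ zs))
        ≡⟨ cong (λ l → 2 * length l) (filter-++ P? (x ∷ y ∷ []) zs) ⟩
      2 * length (filter P? (x ∷ y ∷ []) ++ filter P? zs)
        ≡⟨ cong (2 *_) (length-++ (filter P? (x ∷ y ∷ []))) ⟩
      2 * (length (filter P? (x ∷ y ∷ [])) + length (filter P? zs))
        ≡⟨ *-distribˡ-+ 2 (length (filter P? (x ∷ y ∷ []))) _ ⟩
      2 * length (filter P? (x ∷ y ∷ [])) + 2 * length (filter P? zs)
        ≤⟨ +-mono-≤ (pairing-majority (x ∷ y ∷ []) (λ ()) (xy ∷ [])) (pairing-majority zs (λ ()) rest) ⟩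
      2 + length zs ∎
      where open ≤-Reasoning

module _ {n : ℕ} where

  private
    singletonIf : Bool → Fin n → List (Fin n)
    singletonIf b x = if b then x ∷ [] else []

  partners : Fin n → List (Fin n × Fin n) → List (Fin n)
  partners k []             = []
  partners k ((x , y) ∷ es) = singletonIf ⌊ x ≟ k ⌋ y ++ singletonIf ⌊ y ≟ k ⌋ x ++ partners k es

  ∈-partners⁺ˡ : ∀ {k y es} → (k , y) ∈ es → y ∈ partners k es
  ∈-partners⁺ˡ {k} (here refl) with k ≟ k
  ... | yes _   = here refl
  ... | no k≢k = contradiction refl k≢k
  ∈-partners⁺ˡ {k} {es = (x , z) ∷ _} (there e) =
    ∈-++⁺ʳ (singletonIf ⌊ x ≟ k ⌋ z) (∈-++⁺ʳ (singletonIf ⌊ z ≟ k ⌋ x) (∈-partners⁺ˡ e))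

  ∈-partners⁺ʳ : ∀ {k x es} → (x , k) ∈ es → x ∈ partners k es
  ∈-partners⁺ʳ {k} {x} (here refl) with k ≟ k
  ... | yes _   = ∈-++⁺ʳ (singletonIf ⌊ x ≟ k ⌋ k) (here refl)
  ... | no k≢k = contradiction refl k≢k
  ∈-partners⁺ʳ {k} {es = (y , z) ∷ _} (there e) =
    ∈-++⁺ʳ (singletonIf ⌊ y ≟ k ⌋ z) (∈-++⁺ʳ (singletonIf ⌊ z ≟ k ⌋ y) (∈-partners⁺ʳ e))

  private
    δ : Fin n → Fin n → ℕ
    δ x k = b2n ⌊ x ≟ k ⌋

    length-singletonIf : ∀ b x → length (singletonIf b x) ≡ b2n b
    length-singletonIf true  _ = refl
    length-singletonIf false _ = refl

    length-partners-∷ : ∀ k x y es →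
                        length (partners k ((x , y) ∷ es)) ≡ δ x k + (δ y k + length (partners k es))
    length-partners-∷ k x y es = begin
      length (singletonIf ⌊ x ≟ k ⌋ y ++ singletonIf ⌊ y ≟ k ⌋ x ++ partners k es)
        ≡⟨ length-++ (singletonIf ⌊ x ≟ k ⌋ y) ⟩
      length (singletonIf ⌊ x ≟ k ⌋ y) + length (singletonIf ⌊ y ≟ k ⌋ x ++ partners k es)
        ≡⟨ cong₂ _+_ (length-singletonIf ⌊ x ≟ k ⌋ y) (length-++ (singletonIf ⌊ y ≟ k ⌋ x)) ⟩
      δ x k + (length (singletonIf ⌊ y ≟ k ⌋ x) + length (partners k es))
        ≡⟨ cong (λ m → δ x k + (m + length (partners k es))) (length-singletonIf ⌊ y ≟ k ⌋ x) ⟩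
      δ x k + (δ y k + length (partners k es)) ∎
      where open ≡-Reasoning

  length-partners-pairing : ∀ k xs → length (partners k (pairing xs)) ≤ 2 * length (filter (_≟ k) xs)
  length-partners-pairing k []               = z≤n
  length-partners-pairing k (_ ∷ [])         = z≤n
  length-partners-pairing k (x ∷ y ∷ [])
    rewrite length-partners-∷ k x y [] | length-filter-∷ (_≟ k) x (y ∷ []) | length-filter-∷ (_≟ k) y []
    = m≤m+n _ _
  length-partners-pairing k (x ∷ y ∷ z ∷ [])
    rewrite length-partners-∷ k x y ((x , z) ∷ (y , z) ∷ []) | length-partners-∷ k x z ((y , z) ∷ [])
          | length-partners-∷ k y z [] | length-filter-∷ (_≟ k) x (y ∷ z ∷ [])
          | length-filter-∷ (_≟ k) y (z ∷ []) | length-filter-∷ (_≟ k) z []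
    = ≤-reflexive (solve 3 (λ a b c → a :+ (b :+ (a :+ (c :+ (b :+ (c :+ con 0)))))
                                    := con 2 :* (a :+ (b :+ (c :+ con 0))))
                           refl (δ x k) (δ y k) (δ z k))
    where open +-*-Solver
  length-partners-pairing k (x ∷ y ∷ zs@(_ ∷ _ ∷ _)) = begin
    length (partners k ((x , y) ∷ pairing zs))
      ≡⟨ length-partners-∷ k x y (pairing zs) ⟩
    δ x k + (δ y k + length (partners k (pairing zs)))
      ≤⟨ +-monoʳ-≤ (δ x k) (+-monoʳ-≤ (δ y k) (length-partners-pairing k zs)) ⟩
    δ x k + (δ y k + 2 * O)
      ≤⟨ m≤m+n _ (δ x k + δ y k) ⟩
    δ x k + (δ y k + 2 * O) + (δ x k + δ y k)
      ≡⟨ solve 3 (λ a b o → a :+ (b :+ con 2 :* o) :+ (a :+ b) := con 2 :* (a :+ (b :+ o)))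
                 refl (δ x k) (δ y k) O ⟩
    2 * (δ x k + (δ y k + O))
      ≡⟨ cong (2 *_) (trans (length-filter-∷ (_≟ k) x (y ∷ zs))
                            (cong (δ x k +_) (length-filter-∷ (_≟ k) y zs))) ⟨
    2 * length (filter (_≟ k) (x ∷ y ∷ zs)) ∎
    where
    open ≤-Reasoning
    open +-*-Solver
    O = length (filter (_≟ k) zs)

-- Greedy colouring

fresh : ∀ {K} (xs : List (Fin K)) → length xs < K → ∃ λ α → α ∉ xs
fresh {K} xs |xs|<K =
  ¬∀⟶∃¬ K (_∈ xs) (λ α → Any.any? (α ≟_) xs) λ all → <⇒≱ |xs|<K (injective⇒≤ (index-injective all))
  where
  index-injective : (all : ∀ α → α ∈ xs) → ∀ {α β} → index (all α) ≡ index (all β) → α ≡ β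
  index-injective all {α} {β} eq =
    trans (lookup-index (all α)) (trans (cong (lookup xs) eq) (sym (lookup-index (all β))))

module _ {n D : ℕ} (forbidden : Fin n → List (Fin n)) (few : ∀ v → length (forbidden v) ≤ D)
         {r} {R : Fin n → Fin n → Set r} (R-irrefl : ∀ {v} → ¬ R v v)
         (forbiddenˡ : ∀ {u w} → R u w → w ∈ forbidden u)
         (forbiddenʳ : ∀ {u w} → R u w → u ∈ forbidden w) where

  private
    Proper : (Fin n → Fin (suc D)) → ℕ → Set r
    Proper c j = ∀ {u w} → R u w → toℕ u < j → toℕ w < j → c u ≢ c w

    extend : ∀ {j} → j < n → ∀ c → Proper c j → Σ (Fin n → Fin (suc D)) λ c′ → Proper c′ (suc j)
    extend {j} j<n c proper = c′ , proper′
      where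
      v = fromℕ< j<n
      free = fresh (map c (forbidden v)) (s≤s (subst (_≤ D) (sym (length-map c (forbidden v))) (few v)))
      c′ = updateAt c v (λ _ → proj₁ free)

      below : ∀ {u} → toℕ u < suc j → u ≢ v → toℕ u < j
      below u<1+j u≢v =
        ≤∧≢⇒< (s≤s⁻¹ u<1+j) (λ eq → u≢v (toℕ-injective (trans eq (sym (toℕ-fromℕ< j<n)))))

      proper′ : Proper c′ (suc j)
      proper′ {u} {w} uRw u<1+j w<1+j with u ≟ v | w ≟ v
      ... | yes refl | yes refl = λ _ → R-irrefl uRw
      ... | yes refl | no w≢v  = λ eq → proj₂ free (subst (_∈ map c (forbidden v))
        (trans (sym (updateAt-minimal w v c w≢v)) (trans (sym eq) (updateAt-updates v c)))
        (∈-map⁺ c (forbiddenˡ uRw)))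
      ... | no u≢v  | yes refl = λ eq → proj₂ free (subst (_∈ map c (forbidden v))
        (trans (sym (updateAt-minimal u v c u≢v)) (trans eq (updateAt-updates v c)))
        (∈-map⁺ c (forbiddenʳ uRw)))
      ... | no u≢v  | no w≢v  = λ eq → proper uRw (below u<1+j u≢v) (below w<1+j w≢v)
        (trans (sym (updateAt-minimal u v c u≢v)) (trans eq (updateAt-minimal w v c w≢v)))

    colour-prefix : ∀ j → j ≤ n → Σ (Fin n → Fin (suc D)) λ c → Proper c j
    colour-prefix zero    _   = (λ _ → zero) , λ _ ()
    colour-prefix (suc j) j<n with c , proper ← colour-prefix j (≤-trans (n≤1+n j) j<n) = extend j<n c proper

  greedy-colouring : Σ (Fin n → Fin (suc D)) λ c → ∀ {u w} → R u w → c u ≢ c w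
  greedy-colouring with c , proper ← colour-prefix n ≤-refl = c , λ {u} {w} uRw → proper uRw (toℕ<n u) (toℕ<n w)

-- Strong majority colourings with 2Δ + 1 colours

module _ (G : Graph) where

  neighbours : Fin (n G) → List (Fin (n G))
  neighbours v = filterᵇ (adj G v) (allFin (n G))

  deg≡length-neighbours : ∀ v → deg G v ≡ length (neighbours v)
  deg≡length-neighbours v = count≡length-filterᵇ (λ i → i) (adj G v)

  colourDeg≡length-neighbours : ∀ {k} (c : Fin (n G) → Fin k) v α →
                                colourDeg G c v α ≡ length (filter (λ u → c u ≟ α) (neighbours v))
  colourDeg≡length-neighbours c v α = count∧≡length-filter (λ i → i) (adj G v) (λ u → c u ≟ α)

  occurrences-neighbours : ∀ v k → length (filter (_≟ k) (neighbours v)) ≡ b2n (adj G v k)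
  occurrences-neighbours v k =
    trans (sym (count∧≡length-filter (λ i → i) (adj G v) (_≟ k))) (count-∧-≟ʳ (adj G v) k)

  neighbours-unique : ∀ v → Unique (neighbours v)
  neighbours-unique v = Unique.filter⁺ _ (Unique.allFin⁺ (n G))

  deg≤maxDeg : ∀ v → deg G v ≤ maxDeg G
  deg≤maxDeg v = foldr-preservesᵒ (λ x y → [ m≤n⇒m≤n⊔o y , m≤n⇒m≤o⊔n x ]′) 0 _
    (inj₂ (Any.map ≤-reflexive (∈-map⁺ (deg G) (∈-allFin v))))

  maxDeg≤ : ∀ {D} → (∀ v → deg G v ≤ D) → maxDeg G ≤ D
  maxDeg≤ {D} deg≤D = foldr-preservesᵇ {P = _≤ D} ⊔-lub z≤n (All.map⁺ (All.tabulate⁺ deg≤D))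

  Paired : Fin (n G) → Fin (n G) → Set
  Paired u w = ∃ λ v → (u , w) ∈ pairing (neighbours v)

  paired-irrefl : ∀ {v} → ¬ Paired v v
  paired-irrefl (v , vv∈) = All.lookup (pairing⁺ (neighbours-unique v)) vv∈ refl

  forbidden : Fin (n G) → List (Fin (n G))
  forbidden k = concat (tabulate (λ v → partners k (pairing (neighbours v))))

  length-forbidden : ∀ k → length (forbidden k) ≤ 2 * maxDeg G
  length-forbidden k = begin
    length (forbidden k)
      ≤⟨ length-concat-tabulate _ (λ v → adj G v k) 2 (λ v →
           subst (λ o → length (partners k (pairing (neighbours v))) ≤ 2 * o) (occurrences-neighbours v k)
                 (length-partners-pairing k (neighbours v))) ⟩
    2 * count (λ v → adj G v k)
      ≡⟨ cong (2 *_) (count-cong _ _ (λ v → Graph.sym G v k)) ⟩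
    2 * deg G k
      ≤⟨ *-monoʳ-≤ 2 (deg≤maxDeg k) ⟩
    2 * maxDeg G ∎
    where open ≤-Reasoning

  pairing-colouring : Σ (Fin (n G) → Fin (suc (2 * maxDeg G))) λ c → ∀ {u w} → Paired u w → c u ≢ c w
  pairing-colouring = greedy-colouring forbidden length-forbidden paired-irrefl
    (λ (v , uw∈) → ∈-concat⁺′ (∈-partners⁺ˡ uw∈) (∈-tabulate⁺ v))
    (λ (v , uw∈) → ∈-concat⁺′ (∈-partners⁺ʳ uw∈) (∈-tabulate⁺ v))

  pairing-colouring-majority : MinDegAtLeast G 2 → ∀ {k} {c : Fin (n G) → Fin k} →
                               (∀ {u w} → Paired u w → c u ≢ c w) → IsStrongMajorityColouring G c
  pairing-colouring-majority δ≥2 {c = c} separates v α =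
    subst₂ _≤_ (cong (2 *_) (sym (colourDeg≡length-neighbours c v α))) (sym (deg≡length-neighbours v))
      (pairing-majority (λ u → c u ≟ α) (neighbours v)
        (λ |N|≡1 → <-irrefl refl (subst (2 ≤_) (trans (deg≡length-neighbours v) |N|≡1) (δ≥2 v)))
        (All.tabulate λ uw∈ (cu≡α , cw≡α) → separates (v , uw∈) (trans cu≡α (sym cw≡α))))

  strong-majority-colouring : MinDegAtLeast G 2 → HasStrongMajorityColouring G (suc (2 * maxDeg G))
  strong-majority-colouring δ≥2 =
    let c , separates = pairing-colouring in c , pairing-colouring-majority δ≥2 separates

  distinct-colours : ∀ {k} {c : Fin (n G) → Fin k} → IsStrongMajorityColouring G c →
                     ∀ {w u u′} → T (adj G w u) → T (adj G w u′) → deg G w ≤ 3 → u ≢ u′ → c u ≢ c u′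
  distinct-colours {c = c} majority {w} {u} wu wu′ deg≤3 u≢u′ cu≡cu′ = <-irrefl refl (begin
    4                         ≤⟨ *-monoʳ-≤ 2 two-of-colour ⟩
    2 * colourDeg G c w (c u) ≤⟨ majority w (c u) ⟩
    deg G w                   ≤⟨ deg≤3 ⟩
    3                         ∎)
    where
    open ≤-Reasoning
    two-of-colour : 2 ≤ colourDeg G c w (c u)
    two-of-colour = count≥2 _ u≢u′ (Equivalence.from T-∧ (wu , fromWitness refl))
                                   (Equivalence.from T-∧ (wu′ , fromWitness (sym cu≡cu′)))

-- Minimal colourings

module _ {p} {P : ℕ → Set p} (P? : Decidable P) where

  private
    least-below : ∀ n → (∃ λ m → m < n × P m × (∀ j → j < m → ¬ P j)) ⊎ (∀ j → j < n → ¬ P j)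
    least-below zero = inj₂ λ _ ()
    least-below (suc n) with least-below n
    ... | inj₁ (m , m<n , least-m) = inj₁ (m , m<n⇒m<1+n m<n , least-m)
    ... | inj₂ none with P? n
    ...   | yes pn = inj₁ (n , ≤-refl , pn , none)
    ...   | no ¬pn = inj₂ λ j j<1+n → case j ℕ.≟ n of λ where
              (yes refl) → ¬pn
              (no j≢n)   → none j (≤∧≢⇒< (s≤s⁻¹ j<1+n) j≢n)

  least : ∀ {n} → P n → ∃ λ m → (P m × (∀ j → j < m → ¬ P j)) × m ≤ n
  least {n} pn with least-below (suc n)
  ... | inj₁ (m , m<1+n , pm , below) = m , (pm , below) , s≤s⁻¹ m<1+n
  ... | inj₂ none                     = contradiction pn (none n ≤-refl)

∃-Fin→? : ∀ {p} m {k} {P : (Fin m → Fin k) → Set p} →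
          (∀ {f g} → f ≗ g → P f → P g) → (∀ f → Dec (P f)) → Dec (∃ P)
∃-Fin→? zero    resp P? = map′ (_ ,_) (λ (f , pf) → resp (λ ()) pf) (P? (λ ()))
∃-Fin→? (suc m) resp P? =
  map′ (λ (a , f , pf) → a ∷ᶠ f , pf)
       (λ (f , pf) → f zero , f ∘ suc , resp (λ { zero → refl ; (suc i) → refl }) pf)
       (any? λ a → ∃-Fin→? m (λ f≗g → resp (λ { zero → refl ; (suc i) → f≗g i }))
                                (λ f → P? (a ∷ᶠ f)))

isStrongMajorityColouring? : (G : Graph) {k : ℕ} (c : Fin (n G) → Fin k) → Dec (IsStrongMajorityColouring G c)
isStrongMajorityColouring? G c = all? λ v → all? λ α → 2 * colourDeg G c v α ≤? deg G v

hasStrongMajorityColouring? : (G : Graph) (k : ℕ) → Dec (HasStrongMajorityColouring G k)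
hasStrongMajorityColouring? G k = ∃-Fin→? (n G) respects (isStrongMajorityColouring? G)
  where
  respects : ∀ {c c′ : Fin (n G) → Fin k} → c ≗ c′ →
             IsStrongMajorityColouring G c → IsStrongMajorityColouring G c′
  respects c≗c′ majority v α = subst (λ d → 2 * d ≤ deg G v)
    (count-cong _ _ λ u → cong (λ β → adj G v u ∧ ⌊ β ≟ α ⌋) (c≗c′ u)) (majority v α)

Maj≤2Δ+1 : (G : Graph) → MinDegAtLeast G 2 → Σ ℕ (λ m → MajIs G m × m ≤ 2 * maxDeg G + 1)
Maj≤2Δ+1 G δ≥2 =
  let m , maj , m≤ = least (hasStrongMajorityColouring? G) (strong-majority-colouring G δ≥2) in
  m , maj , subst (m ≤_) (+-comm 1 (2 * maxDeg G)) m≤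

-- Incidence graphs of triple systems

module _ {v b : ℕ} (I : Fin v → Fin b → Bool) where

  private
    link : Fin v ⊎ Fin b → Fin v ⊎ Fin b → Bool
    link (inj₁ x) (inj₂ β) = I x β
    link (inj₂ β) (inj₁ x) = I x β
    link (inj₁ _) (inj₁ _) = false
    link (inj₂ _) (inj₂ _) = false

    link-sym : ∀ s t → link s t ≡ link t s
    link-sym (inj₁ _) (inj₁ _) = refl
    link-sym (inj₁ _) (inj₂ _) = refl
    link-sym (inj₂ _) (inj₁ _) = refl
    link-sym (inj₂ _) (inj₂ _) = refl

    link-irrefl : ∀ s → link s s ≡ false
    link-irrefl (inj₁ _) = refl
    link-irrefl (inj₂ _) = refl

  incidenceGraph : Graph
  incidenceGraph = record
    { n      = v + b
    ; adj    = λ i j → link (splitAt v i) (splitAt v j)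
    ; sym    = λ i j → link-sym (splitAt v i) (splitAt v j)
    ; irrefl = λ i → link-irrefl (splitAt v i)
    }

  deg-incidenceGraph : ∀ i →
    deg incidenceGraph i ≡ [ count ∘ I , (λ β → count (λ x → I x β)) ]′ (splitAt v i)
  deg-incidenceGraph i = trans (count-splitAt v (link (splitAt v i))) (degree (splitAt v i))
    where
    degree : ∀ s → count (λ x → link s (inj₁ x)) + count (λ β → link s (inj₂ β))
                 ≡ [ count ∘ I , (λ β → count (λ x → I x β)) ]′ s
    degree (inj₁ x) = cong (_+ count (I x)) (count-false v)
    degree (inj₂ β) = trans (cong (count (λ x → I x β) +_) (count-false b)) (+-identityʳ _)

  adj-incidenceGraph : ∀ x β → adj incidenceGraph (v ↑ʳ β) (x ↑ˡ b) ≡ I x β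
  adj-incidenceGraph x β = cong₂ link (splitAt-↑ʳ v b β) (splitAt-↑ˡ v x b)

module TripleSystem {v b r : ℕ} (I : Fin v → Fin b → Bool)
                    (replication : ∀ x → count (I x) ≡ r)
                    (block-size : ∀ β → count (λ x → I x β) ≡ 3)
                    (pairs-covered : ∀ {x y} → x ≢ y → ∃ λ β → T (I x β) × T (I y β)) where

  private
    G = incidenceGraph I

    degree : Fin v ⊎ Fin b → ℕ
    degree = [ (λ _ → r) , (λ _ → 3) ]′

    deg-G : ∀ i → deg G i ≡ degree (splitAt v i)
    deg-G i = trans (deg-incidenceGraph I i) (replication-or-size (splitAt v i))
      where
      replication-or-size : ∀ s → [ count ∘ I , (λ β → count (λ x → I x β)) ]′ s ≡ degree s
      replication-or-size (inj₁ x) = replication x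
      replication-or-size (inj₂ β) = block-size β

    deg-point : ∀ x → deg G (x ↑ˡ b) ≡ r
    deg-point x = trans (deg-G (x ↑ˡ b)) (cong degree (splitAt-↑ˡ v x b))

    deg-block : ∀ β → deg G (v ↑ʳ β) ≡ 3
    deg-block β = trans (deg-G (v ↑ʳ β)) (cong degree (splitAt-↑ʳ v b β))

  minDeg≥2 : 2 ≤ r → MinDegAtLeast G 2
  minDeg≥2 2≤r i = subst (2 ≤_) (sym (deg-G i)) (two≤ (splitAt v i))
    where
    two≤ : ∀ s → 2 ≤ degree s
    two≤ (inj₁ _) = 2≤r
    two≤ (inj₂ _) = s≤s (s≤s z≤n)

  maxDeg≡r : 3 ≤ r → 0 < v → maxDeg G ≡ r
  maxDeg≡r 3≤r 0<v = ≤-antisym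
    (maxDeg≤ G λ i → subst (_≤ r) (sym (deg-G i)) (≤r (splitAt v i)))
    (subst (_≤ maxDeg G) (deg-point (fromℕ< 0<v)) (deg≤maxDeg G (fromℕ< 0<v ↑ˡ b)))
    where
    ≤r : ∀ s → degree s ≤ r
    ≤r (inj₁ _) = ≤-refl
    ≤r (inj₂ _) = 3≤r

  points≤colours : ∀ {k} → HasStrongMajorityColouring G k → v ≤ k
  points≤colours (c , majority) = injective⇒≤ injective
    where
    injective : ∀ {x y} → c (x ↑ˡ b) ≡ c (y ↑ˡ b) → x ≡ y
    injective {x} {y} eq with x ≟ y
    ... | yes x≡y = x≡y
    ... | no x≢y  =
      let β , xβ , yβ = pairs-covered x≢y in
      contradiction eq (distinct-colours G majority
        (subst T (sym (adj-incidenceGraph I x β)) xβ) (subst T (sym (adj-incidenceGraph I y β)) yβ)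
        (≤-reflexive (deg-block β)) (x≢y ∘ ↑ˡ-injective b x y))

-- Lines of the affine spaces 𝔽₃ᵏ

-- −(a + b) in ℤ/3ℤ, since 2 ≡ −1
third₃ : Fin 3 → Fin 3 → Fin 3
third₃ a b = (2 * (toℕ a + toℕ b)) mod 3

third₃-comm : ∀ a b → third₃ a b ≡ third₃ b a
third₃-comm = toWitness {a? = all? λ a → all? λ b → third₃ a b ≟ third₃ b a} _

third₃-involutive : ∀ a b → third₃ a (third₃ a b) ≡ b
third₃-involutive = toWitness {a? = all? λ a → all? λ b → third₃ a (third₃ a b) ≟ b} _

-- The points of 𝔽₃ᵏ are the elements of Fin (3 ^ k), with 𝔽₃ᵏ⁺¹ ≅ 𝔽₃ × 𝔽₃ᵏ via remQuot and combine.
decodePoint : ∀ k → Fin (3 ^ suc k) → Fin 3 × Fin (3 ^ k)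
decodePoint k = remQuot {3} (3 ^ k)

-- −(p + q) in 𝔽₃ᵏ, the third point of the line through p ≠ q
third : ∀ k → Fin (3 ^ k) → Fin (3 ^ k) → Fin (3 ^ k)
third zero    _ _ = zero
third (suc k) p q = combine (third₃ a b) (third k x y)
  where
  a = proj₁ (decodePoint k p)
  x = proj₂ (decodePoint k p)
  b = proj₁ (decodePoint k q)
  y = proj₂ (decodePoint k q)

third-comm : ∀ k p q → third k p q ≡ third k q p
third-comm zero    _ _ = refl
third-comm (suc k) p q = cong₂ combine (third₃-comm (proj₁ (decodePoint k p)) (proj₁ (decodePoint k q)))
                                       (third-comm k (proj₂ (decodePoint k p)) (proj₂ (decodePoint k q)))

third-involutive : ∀ k p q → third k p (third k p q) ≡ q
third-involutive zero    zero zero = refl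
third-involutive (suc k) p q = begin
  third (suc k) p (third (suc k) p q)
    ≡⟨ cong (λ (b′ , y′) → combine (third₃ a b′) (third k x y′))
            (remQuot-combine (third₃ a b) (third k x y)) ⟩
  combine (third₃ a (third₃ a b)) (third k x (third k x y))
    ≡⟨ cong₂ combine (third₃-involutive a b) (third-involutive k x y) ⟩
  combine b y
    ≡⟨ combine-remQuot {3} (3 ^ k) q ⟩
  q ∎
  where
  open ≡-Reasoning
  a = proj₁ (decodePoint k p)
  x = proj₂ (decodePoint k p)
  b = proj₁ (decodePoint k q)
  y = proj₂ (decodePoint k q)

decodePoint-injective : ∀ k {p q} → decodePoint k p ≡ decodePoint k q → p ≡ q
decodePoint-injective k {p} {q} eq =
  trans (sym (combine-remQuot {3} (3 ^ k) p)) (trans (cong (uncurry combine) eq) (combine-remQuot {3} (3 ^ k) q))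

-- blocks k is the number of lines of 𝔽₃ᵏ.  A line of 𝔽₃ᵏ⁺¹ either meets each layer {a} × 𝔽₃ᵏ
-- once, in (0, u), (1, v), (2, third k u v), or is a line {a} × ℓ of a single layer.
blocks : ℕ → ℕ
blocks zero    = 0
blocks (suc k) = 3 ^ k * 3 ^ k + 3 * blocks k

Block : ℕ → Set
Block k = (Fin (3 ^ k) × Fin (3 ^ k)) ⊎ (Fin 3 × Fin (blocks k))

decodeBlock : ∀ k → Fin (blocks (suc k)) → Block k
decodeBlock k β = Sum.map (remQuot (3 ^ k)) (remQuot (blocks k)) (splitAt (3 ^ k * 3 ^ k) β)

encodeBlock : ∀ k → Block k → Fin (blocks (suc k))
encodeBlock k B = join (3 ^ k * 3 ^ k) (3 * blocks k) (Sum.map (uncurry combine) (uncurry combine) B)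

decode-encode : ∀ k B → decodeBlock k (encodeBlock k B) ≡ B
decode-encode k (inj₁ (u , v)) rewrite splitAt-↑ˡ (3 ^ k * 3 ^ k) (combine u v) (3 * blocks k) =
  cong inj₁ (remQuot-combine u v)
decode-encode k (inj₂ (a , β)) rewrite splitAt-↑ʳ (3 ^ k * 3 ^ k) (3 * blocks k) (combine a β) =
  cong inj₂ (remQuot-combine a β)

transversal : ∀ k → Fin (3 ^ k) → Fin (3 ^ k) → Fin 3 → Fin (3 ^ k)
transversal k u v zero             = u
transversal k u v (suc zero)       = v
transversal k u v (suc (suc zero)) = third k u v

incident : ∀ k → Fin (3 ^ k) → Fin (blocks k) → Bool
incidentᵈ : ∀ k → Fin 3 × Fin (3 ^ k) → Block k → Bool

incident zero    _ ()
incident (suc k) p β = incidentᵈ k (decodePoint k p) (decodeBlock k β)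

incidentᵈ k (a , x) (inj₁ (u , v))  = ⌊ x ≟ transversal k u v a ⌋
incidentᵈ k (a , x) (inj₂ (a′ , β)) = ⌊ a ≟ a′ ⌋ ∧ incident k x β

-- the number (3ᵏ − 1)/2 of lines through a point
replication : ℕ → ℕ
replication zero    = 0
replication (suc k) = 3 ^ k + replication k

replication-incident : ∀ k p → count (incident k p) ≡ replication k
transversals-through : ∀ k a x → count (λ t → incidentᵈ k (a , x) (inj₁ (remQuot (3 ^ k) t))) ≡ 3 ^ k
copies-through : ∀ k a x → count (λ c → incidentᵈ k (a , x) (inj₂ (remQuot (blocks k) c))) ≡ replication k

replication-incident zero    p = refl
replication-incident (suc k) p =
  trans (count-splitAt (3 ^ k * 3 ^ k) (incidentᵈ k (a , x) ∘ Sum.map (remQuot (3 ^ k)) (remQuot (blocks k))))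
        (cong₂ _+_ (transversals-through k a x) (copies-through k a x))
  where
  a = proj₁ (decodePoint k p)
  x = proj₂ (decodePoint k p)

transversals-through k zero x = begin
  count (λ t → ⌊ x ≟ proj₁ (remQuot {3 ^ k} (3 ^ k) t) ⌋)
    ≡⟨ count-cong _ (λ t → ⌊ x ≟ proj₁ (remQuot {3 ^ k} (3 ^ k) t) ⌋ ∧ true) (λ _ → sym (∧-identityʳ _)) ⟩
  count (λ t → ⌊ x ≟ proj₁ (remQuot {3 ^ k} (3 ^ k) t) ⌋ ∧ true)
    ≡⟨ count-remQuot-× (λ u → ⌊ x ≟ u ⌋) (λ _ → true) ⟩
  count (λ u → ⌊ x ≟ u ⌋) * count {3 ^ k} (λ _ → true)
    ≡⟨ cong₂ _*_ (count-≟ˡ x) (count-true (3 ^ k)) ⟩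
  1 * 3 ^ k
    ≡⟨ +-identityʳ (3 ^ k) ⟩
  3 ^ k ∎
  where open ≡-Reasoning
transversals-through k (suc zero) x =
  trans (count-remQuot-rows (incidentᵈ k (suc zero , x) ∘ inj₁) (λ _ → count-≟ˡ x)) (*-identityʳ (3 ^ k))
transversals-through k (suc (suc zero)) x =
  trans (count-remQuot-rows (incidentᵈ k (suc (suc zero) , x) ∘ inj₁)
                            (λ u → count-≟-involution (third k u) (third-involutive k u) x))
        (*-identityʳ (3 ^ k))

copies-through k a x =
  trans (count-remQuot-× (λ a′ → ⌊ a ≟ a′ ⌋) (incident k x))
        (trans (cong₂ _*_ (count-≟ˡ a) (replication-incident k x)) (+-identityʳ (replication k)))

block-size : ∀ k β → count (λ p → incident k p β) ≡ 3
block-sizeᵈ : ∀ k B → count (λ p → incidentᵈ k (decodePoint k p) B) ≡ 3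

block-size zero    ()
block-size (suc k) β = block-sizeᵈ k (decodeBlock k β)

block-sizeᵈ k (inj₁ (u , v))  =
  count-remQuot-rows (λ ax → incidentᵈ k ax (inj₁ (u , v))) (λ a → count-≟ʳ (transversal k u v a))
block-sizeᵈ k (inj₂ (a′ , β)) =
  trans (count-remQuot-× (λ a → ⌊ a ≟ a′ ⌋) (λ x → incident k x β))
        (cong₂ _*_ (count-≟ʳ a′) (block-size k β))

transversal-through : ∀ k {a b} → a ≢ b → ∀ x y → ∃ λ ((u , v) : Fin (3 ^ k) × Fin (3 ^ k)) →
                      x ≡ transversal k u v a × y ≡ transversal k u v b
transversal-through k {zero}           {zero}           a≢b _ _ = contradiction refl a≢b
transversal-through k {suc zero}       {suc zero}       a≢b _ _ = contradiction refl a≢b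
transversal-through k {suc (suc zero)} {suc (suc zero)} a≢b _ _ = contradiction refl a≢b
transversal-through k {zero}           {suc zero}       _ x y = (x , y) , refl , refl
transversal-through k {suc zero}       {zero}           _ x y = (y , x) , refl , refl
transversal-through k {zero}           {suc (suc zero)} _ x y = (x , third k x y) , refl , sym (third-involutive k x y)
transversal-through k {suc (suc zero)} {zero}           _ x y = (y , third k y x) , sym (third-involutive k y x) , refl
transversal-through k {suc zero}       {suc (suc zero)} _ x y =
  (third k x y , x) , refl , sym (trans (third-comm k (third k x y) x) (third-involutive k x y))
transversal-through k {suc (suc zero)} {suc zero}       _ x y =
  (third k y x , y) , sym (trans (third-comm k (third k y x) y) (third-involutive k y x)) , refl

pairs-covered : ∀ k {p q} → p ≢ q → ∃ λ β → T (incident k p β) × T (incident k q β)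
pairs-coveredᵈ : ∀ k {P Q} → P ≢ Q → ∃ λ B → T (incidentᵈ k P B) × T (incidentᵈ k Q B)

pairs-covered zero    {zero} {zero} p≢q = contradiction refl p≢q
pairs-covered (suc k) {p}    {q}    p≢q =
  let B , pB , qB = pairs-coveredᵈ k (p≢q ∘ decodePoint-injective k) in
  encodeBlock k B , subst (T ∘ incidentᵈ k (decodePoint k p)) (sym (decode-encode k B)) pB
                  , subst (T ∘ incidentᵈ k (decodePoint k q)) (sym (decode-encode k B)) qB

pairs-coveredᵈ k {a , x} {b , y} P≢Q with a ≟ b
... | yes refl =
  let β , xβ , yβ = pairs-covered k (P≢Q ∘ cong (a ,_)) in
  inj₂ (a , β) , Equivalence.from T-∧ (fromWitness refl , xβ) , Equivalence.from T-∧ (fromWitness refl , yβ)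
... | no a≢b   =
  let uv , x≡ , y≡ = transversal-through k a≢b x y in
  inj₁ uv , fromWitness x≡ , fromWitness y≡

2*replication+1≡3^ : ∀ k → 2 * replication k + 1 ≡ 3 ^ k
2*replication+1≡3^ zero    = refl
2*replication+1≡3^ (suc k) = begin
  2 * (3 ^ k + replication k) + 1
    ≡⟨ solve 2 (λ t r → con 2 :* (t :+ r) :+ con 1 := t :+ t :+ (con 2 :* r :+ con 1))
               refl (3 ^ k) (replication k) ⟩
  3 ^ k + 3 ^ k + (2 * replication k + 1)
    ≡⟨ cong (3 ^ k + 3 ^ k +_) (2*replication+1≡3^ k) ⟩
  3 ^ k + 3 ^ k + 3 ^ k
    ≡⟨ solve 1 (λ t → t :+ t :+ t := con 3 :* t) refl (3 ^ k) ⟩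
  3 * 3 ^ k ∎
  where
  open ≡-Reasoning
  open +-*-Solver

k≤replication : ∀ k → k ≤ replication k
k≤replication zero    = z≤n
k≤replication (suc k) = +-mono-≤ (m^n>0 3 k) (k≤replication k)

extremal-graphs : (N : ℕ) → Σ ℕ (λ Δ → N ≤ Δ × Σ Graph (λ G →
                  MinDegAtLeast G 2 × maxDeg G ≡ Δ × MajIs G (2 * Δ + 1)))
extremal-graphs N = Δ , ≤-trans (m≤n+m N 3) k≤Δ , G , δ≥2 , maxDeg≡Δ , colouring , no-fewer
  where
  -- k ≥ 3 makes Δ ≥ 3, so that the blocks, of degree 3, do not raise the maximum degree.
  k = 3 + N
  Δ = replication k
  k≤Δ = k≤replication k
  open TripleSystem (incident k) (replication-incident k) (block-size k) (pairs-covered k)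
  G = incidenceGraph (incident k)
  δ≥2 = minDeg≥2 (≤-trans (n≤1+n 2) (≤-trans (m≤m+n 3 N) k≤Δ))
  maxDeg≡Δ = maxDeg≡r (≤-trans (m≤m+n 3 N) k≤Δ) (m^n>0 3 k)

  colouring : HasStrongMajorityColouring G (2 * Δ + 1)
  colouring = subst (HasStrongMajorityColouring G)
                    (trans (cong (λ d → suc (2 * d)) maxDeg≡Δ) (+-comm 1 (2 * Δ)))
                    (strong-majority-colouring G δ≥2)

  no-fewer : ∀ j → j < 2 * Δ + 1 → ¬ HasStrongMajorityColouring G j
  no-fewer j j<2Δ+1 = <⇒≱ (subst (j <_) (2*replication+1≡3^ k) j<2Δ+1) ∘ points≤colours

theorem7 :
    ((G : Graph) → MinDegAtLeast G 2 →
      Σ ℕ (λ m → MajIs G m × m ≤ 2 * maxDeg G + 1))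
    × ((N : ℕ) → Σ ℕ (λ Δ → N ≤ Δ × Σ Graph (λ G →
        MinDegAtLeast G 2 × maxDeg G ≡ Δ × MajIs G (2 * Δ + 1))))
theorem7 = Maj≤2Δ+1 , extremal-graphs
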